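{- There is a Henkin structure of second order that is a model of ${}^hax^{(2)}$ and of $AC_*^{1,1}$, but is not a model of all Asser axioms $choice_*^{2}$ and not a model of all Ackermann axioms $choice^{1,1}$ (i.e. it is a model of ${}^{h}ax^{(2)}\cup\{AC_*^{1,1}\land\neg choice_*^2\land\neg choice^{1,1}\}$).
   Context: Work in second-order predicate logic with Henkin interpretation (HPL); ${}^hax^{(2)}$ is its axiom system, whose models are the Henkin structures of second order (structures $(J_k)_{k\ge0}$ with nonempty individual domain $J_0$ and $J_k$ a set of $k$-ary predicates closed under second-order definability). A variable of sort $k$ ranges over $k$-ary predicates; $\exists!!$ means "there exists exactly one"; for predicate variables $C_1\neq C_2$ means $\neg\forall y(C_1y\leftrightarrow C_2y)$ (with tuples of appropriate length). Russell–Asser axiom ($A$ unary, $R,S$ binary): $AC_*^{1,1}=\forall A\forall R\exists S(\forall x(Ax\leftrightarrow\exists yRxy)\land\forall x_1\forall x_2(Ax_1\land Ax_2\land x_1\neq x_2\to\neg\exists y(Rx_1y\land Rx_2y))\to\forall x(Ax\to\exists!!y(Rxy\land Sxy)))$. Asser axioms of sort 2: for $C,C_1,C_2,D$ binary and $H(C)$ any second-order formula with $C$ free, $choice_*^{2}(H)=\forall C(H(C)\to\exists y_1\exists y_2 Cy_1y_2)\land\forall C_1\forall C_2(H(C_1)\land H(C_2)\land C_1\neq C_2\to\neg\exists y_1\exists y_2(C_1y_1y_2\land C_2y_1y_2))\to\exists D\forall C(H(C)\to\exists!!(y_1,y_2)(Cy_1y_2\land Dy_1y_2))$; $choice_*^2$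 is the set of all these. Ackermann axioms ($D$ unary, $S$ binary, $H(x,D)$ any second-order formula in which $x$ and $D$ occur free): $choice^{1,1}(H)=\forall x\exists D H(x,D)\to\exists S\forall x H(x,\lambda y.Sxy)$; $choice^{1,1}$ is the set of all these. -}

module Defs where

open import Level using (Lift)
open import Data.Nat using (ℕ; zero; suc; _≟_)
open import Data.Vec using (Vec; []; _∷_; map)
open import Data.Product using (Σ; _×_; _,_; proj₁)
open import Relation.Nullary using (¬_; yes; no)
open import Relation.Binary.PropositionalEquality using (_≡_; refl)

-- Model theory of HPL is
-- classical; we read "exists" as ¬∀¬ and atoms/equality as ¬¬-stable,
-- so all satisfaction clauses below are the Gödel–Gentzen reading of the
-- usual Tarskian clauses (classically equivalent to them).

∃c : ∀ {a b} {A : Set a} → (A → Set b) → Set _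
∃c {A = A} P = ¬ ((x : A) → ¬ P x)

_⇔c_ : ∀ {a b} → Set a → Set b → Set _
A ⇔c B = (A → B) × (B → A)

Pred : Set → ℕ → Set₁
Pred D n = Vec D n → Set

-- A second-order frame (J_k)_{k≥0}: J_0 = D is the individual domain and,
-- for the sort of (suc k)-ary predicates, J k is the set (membership
-- predicate) of admitted (suc k)-ary predicates.
record Frame : Set₁ where
  field
    D : Set
    J : (k : ℕ) → Pred D (suc k) → Set

-- Primitive connectives ¬, ∧, ∀
-- (individual and predicate); the others are classical abbreviations.

data Form : Set where
  _≐_  : ℕ → ℕ → Form
  app  : (k : ℕ) → ℕ → Vec ℕ (suc k) → Form
  ¬ᶠ   : Form → Form
  _∧ᶠ_ : Form → Form → Form
  ∀ᵢ   : ℕ → Form → Form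
  ∀ₚ   : (k : ℕ) → ℕ → Form → Form

record Asg (D : Set) : Set₁ where
  field
    ind  : ℕ → D
    pred : (k : ℕ) → ℕ → Pred D (suc k)

open Asg public

updI : {A : Set} → (ℕ → A) → ℕ → A → ℕ → A
updI f x a y with x ≟ y
... | yes _ = a
... | no _  = f y

updP : {A : ℕ → Set₁} → ((k : ℕ) → ℕ → A k) → (k : ℕ) → ℕ → A k → (k' : ℕ) → ℕ → A k'
updP f k X a k' Y with k ≟ k' | X ≟ Y
... | yes refl | yes _ = a
... | _        | _     = f k' Y

setI : {D : Set} → Asg D → ℕ → D → Asg D
setI s x a = record { ind = updI (ind s) x a ; pred = pred s }

setP : {D : Set} → Asg D → (k : ℕ) → ℕ → Pred D (suc k) → Asg D
setP {D} s k X P = record { ind = ind s ; pred = updP {A = λ k → Pred D (suc k)} (pred s) k X P }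

setVec : {D : Set} {n : ℕ} → Asg D → Vec ℕ n → Vec D n → Asg D
setVec s []       []       = s
setVec s (x ∷ xs) (a ∷ as) = setI (setVec s xs as) x a

Valid : (F : Frame) → Asg (Frame.D F) → Set
Valid F s = (k X : ℕ) → Frame.J F k (pred s k X)

sat : (F : Frame) → Asg (Frame.D F) → Form → Set₁
sat F s (x ≐ y)       = Lift _ (¬ ¬ (ind s x ≡ ind s y))
sat F s (app k X xs)  = Lift _ (¬ ¬ pred s k X (map (ind s) xs))
sat F s (¬ᶠ φ)        = ¬ sat F s φ
sat F s (φ ∧ᶠ ψ)      = sat F s φ × sat F s ψ
sat F s (∀ᵢ x φ)      = (a : Frame.D F) → sat F (setI s x a) φ
sat F s (∀ₚ k X φ)    = (P : Pred (Frame.D F) (suc k)) → Frame.J F k P → sat F (setP s k X P) φ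

-- Henkin structures of second order = models of ^h ax^(2):
-- nonempty individual domain, and every J_k closed under second-order
-- definability (comprehension with parameters).

record HenkinStructure : Set₁ where
  field
    frame : Frame
  open Frame frame
  field
    inhabited     : D
    nonemptyJ     : (k : ℕ) → Σ (Pred D (suc k)) (J k)
    comprehension : (φ : Form) (k : ℕ) (xs : Vec ℕ (suc k)) (s : Asg D) → Valid frame s →
                    Σ (Pred D (suc k)) λ P → J k P ×
                      ((v : Vec D (suc k)) → (¬ ¬ P v) ⇔c sat frame (setVec s xs v) φ)

-- The axioms, written as their (classical) satisfaction conditions.

module _ (F : Frame) where
  open Frame F

  _≈_ : D → D → Set
  x ≈ y = ¬ ¬ (x ≡ y)

  at1 : Pred D 1 → D → Set
  at1 A x = ¬ ¬ A (x ∷ [])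

  at2 : Pred D 2 → D → D → Set
  at2 R x y = ¬ ¬ R (x ∷ y ∷ [])

  ∃!! : ∀ {b} → (D → Set b) → Set _
  ∃!! P = ∃c λ y → P y × ((z : D) → P z → z ≈ y)

  ∃!!₂ : ∀ {b} → (D → D → Set b) → Set _
  ∃!!₂ P = ∃c λ y1 → ∃c λ y2 → P y1 y2 × ((z1 z2 : D) → P z1 z2 → (z1 ≈ y1) × (z2 ≈ y2))

  _≉₂_ : Pred D 2 → Pred D 2 → Set
  C1 ≉₂ C2 = ¬ ((y1 y2 : D) → at2 C1 y1 y2 ⇔c at2 C2 y1 y2)

  AC11 : Set₁
  AC11 =
    (A : Pred D 1) → J 0 A → (R : Pred D 2) → J 1 R →
    ∃c λ (S : Σ (Pred D 2) (J 1)) →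
      (((x : D) → at1 A x ⇔c ∃c (λ y → at2 R x y))
       × ((x1 x2 : D) → at1 A x1 → at1 A x2 → ¬ (x1 ≈ x2) →
            ¬ ∃c (λ y → at2 R x1 y × at2 R x2 y)))
      → (x : D) → at1 A x → ∃!! (λ y → at2 R x y × at2 (proj₁ S) x y)

  -- M ⊨ choice_*^2(H), where C is the binary predicate variable named c
  -- (sort k = 1), and the axiom is read as its universal closure.
  Choice2 : Form → ℕ → Set₁
  Choice2 H c =
    (s : Asg D) → Valid F s →
    let h : Pred D 2 → Set₁
        h C = sat F (setP s 1 c C) H
    in (((C : Pred D 2) → J 1 C → h C → ∃c λ y1 → ∃c λ y2 → at2 C y1 y2)
        × ((C1 C2 : Pred D 2) → J 1 C1 → J 1 C2 → h C1 → h C2 → C1 ≉₂ C2 →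
             ¬ ∃c (λ y1 → ∃c λ y2 → at2 C1 y1 y2 × at2 C2 y1 y2)))
       → ∃c λ (Dp : Σ (Pred D 2) (J 1)) →
           (C : Pred D 2) → J 1 C → h C → ∃!!₂ (λ y1 y2 → at2 C y1 y2 × at2 (proj₁ Dp) y1 y2)

  -- M ⊨ choice^{1,1}(H), where x is the individual variable named x and D
  -- the unary predicate variable named d (sort k = 0); universal closure.
  -- H(x, λy.Sxy) is interpreted by assigning the predicate y ↦ S x y to D.
  Choice11 : Form → ℕ → ℕ → Set₁
  Choice11 H x d =
    (s : Asg D) → Valid F s →
    ((a : D) → ∃c λ (P : Σ (Pred D 1) (J 0)) → sat F (setP (setI s x a) 0 d (proj₁ P)) H)
    → ∃c λ (S : Σ (Pred D 2) (J 1)) →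
        (a : D) → sat F (setP (setI s x a) 0 d (λ v → proj₁ S (a ∷ v))) H

{-# OPTIONS --safe #-}
-- A permutation model.  Atoms (m , p , e) are grouped into blocks m, each block into two
-- poles p, each pole into two partner atoms e.  The symmetries are generated by exchanging two
-- blocks and by exchanging the two atoms of one pole; a predicate is admissible when it is
-- (up to ¬¬) a Boolean test invariant under every symmetry fixing the blocks of a finite
-- support.  A definable predicate is supported by the blocks of its individual parameters
-- together with the supports of its predicate parameters, and a supported predicate only has
-- to be inspected at the finitely many atoms of its support plus one fresh block, so it can be
-- decided classically under ¬¬: this gives comprehension.
--
-- AC_*^{1,1}: outside the support of R, flipping the pole of x moves x to its partner and
-- fixes all other atoms, so with disjoint fibres the fibre of x lies in {x, partner x};
-- choosing x if possible and its partner otherwise is invariant, and inside the support only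
-- finitely many choices are needed.  choice_*^2 and choice^{1,1} fail for one reason: for an
-- atom x in a block outside the support of a purported selector S, exchanging the two atoms
-- of the pole opposite to x fixes x and S, so S cannot single out one of them.

module Submission where

open import Defs
open import Level using (0ℓ; lift; lower)
open import Data.Bool using (Bool; true; false; not; _∧_; _xor_; T; T?)
open import Data.Bool.Properties
  using (xor-assoc; xor-comm; xor-same; ∧-zeroʳ; not-¬; not-involutive) renaming (_≟_ to _≟ᵇ_)
open import Data.Empty using (⊥)
open import Data.List using (List; []; _∷_; _++_; concatMap; cartesianProduct)
import Data.List as List
open import Data.List.Extrema.Nat using (max; xs≤max)
open import Data.List.Membership.Propositional using (_∈_; _∉_)
open import Data.List.Membership.Propositional.Properties
  using (∈-++⁺ˡ; ∈-++⁺ʳ; ∈-map⁺; ∈-concat⁺′; ∈-cartesianProduct⁺; ∈-cartesianProduct⁻)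
open import Data.List.Relation.Binary.Disjoint.Propositional using (Disjoint)
open import Data.List.Relation.Binary.Disjoint.Propositional.Properties using () renaming (sym to disjoint-sym)
open import Data.List.Relation.Binary.Subset.Propositional using (_⊆_)
open import Data.List.Relation.Unary.All using (All; tabulate; sequenceM) renaming (lookup to lookupAll)
open import Data.List.Relation.Unary.Any using (here; there)
open import Data.Nat using (ℕ; zero; suc; _≟_)
open import Data.Nat.Properties using (1+n≰n)
open import Data.Product using (Σ; _×_; _,_; proj₁; proj₂)
open import Data.Product.Function.NonDependent.Propositional using (_×-⇔_)
open import Data.Product.Properties using (≡-dec)
open import Data.Sum using (_⊎_; inj₁; inj₂; [_,_])
open import Data.Vec using (Vec; []; _∷_; map; toList)
open import Data.Vec.Properties using (map-∘; map-cong; map-id)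
open import Effect.Monad using (RawMonad)
open import Function using (_∘_; _⇔_; mk⇔; Equivalence)
open import Function.Properties.Equivalence using () renaming (sym to ⇔-sym; trans to ⇔-trans)
open import Function.Related.TypeIsomorphisms using (¬-cong-⇔)
open import Relation.Binary using (DecidableEquality)
open import Relation.Binary.PropositionalEquality
  using (_≡_; _≢_; refl; sym; trans; cong; cong₂; subst; subst₂)
open import Relation.Nullary using (¬_; Dec; yes; no; contradiction; ¬?; _×-dec_)
open import Relation.Nullary.Decidable
  using (⌊_⌋; does; does-⇔; dec-true; dec-false; toWitness; fromWitness; decidable-stable; ¬¬-excluded-middle)
open import Relation.Nullary.Negation using (¬¬-Monad; ¬¬-map; Stable; independence-of-premise)
open import Relation.Unary using (Decidable)

open Equivalence using (to; from)
open RawMonad (¬¬-Monad {0ℓ}) using (_>>=_)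

Atom : Set
Atom = ℕ × Bool × Bool

block : Atom → ℕ
block (m , _ , _) = m

pole : Atom → Bool
pole (_ , p , _) = p

partner : Atom → Atom
partner (m , p , e) = m , p , not e

_≟ₐ_ : DecidableEquality Atom
_≟ₐ_ = ≡-dec _≟_ (≡-dec _≟ᵇ_ _≟ᵇ_)

transpose : ℕ → ℕ → ℕ → ℕ
transpose i j a with a ≟ i | a ≟ j
... | yes _ | _     = j
... | no _  | yes _ = i
... | no _  | no _  = a

transpose-i : ∀ i j → transpose i j i ≡ j
transpose-i i j with i ≟ i
... | yes _   = refl
... | no i≢i = contradiction refl i≢i

transpose-j : ∀ i j → transpose i j j ≡ i
transpose-j i j with j ≟ i | j ≟ j
... | yes j≡i | _      = j≡i
... | no _    | yes _  = refl
... | no _    | no j≢j = contradiction refl j≢j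

transpose-fixes : ∀ {i j a} → a ≢ i → a ≢ j → transpose i j a ≡ a
transpose-fixes {i} {j} {a} a≢i a≢j with a ≟ i | a ≟ j
... | yes a≡i | _       = contradiction a≡i a≢i
... | no _    | yes a≡j = contradiction a≡j a≢j
... | no _    | no _    = refl

transpose-involutive : ∀ i j a → transpose i j (transpose i j a) ≡ a
transpose-involutive i j a with a ≟ i | a ≟ j
... | yes refl | _        = transpose-j a j
... | no _     | yes refl = transpose-i i a
... | no a≢i   | no a≢j   = transpose-fixes a≢i a≢j

transpose-injective : ∀ i j {a b} → transpose i j a ≡ transpose i j b → a ≡ b
transpose-injective i j {a} {b} eq =
  trans (sym (transpose-involutive i j a)) (trans (cong (transpose i j) eq) (transpose-involutive i j b))

transpose-≢ : ∀ {i j a b} → b ≢ i → b ≢ j → a ≢ b → transpose i j a ≢ b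
transpose-≢ {i} {j} b≢i b≢j a≢b eq =
  a≢b (transpose-injective i j (trans eq (sym (transpose-fixes b≢i b≢j))))

transpose-commute : ∀ {i j k l} → Disjoint (i ∷ j ∷ []) (k ∷ l ∷ []) →
                    ∀ a → transpose i j (transpose k l a) ≡ transpose k l (transpose i j a)
transpose-commute {i} {j} {k} {l} disj a = by-cases (a ≟ k) (a ≟ l)
  where
  k≢i : k ≢ i
  k≢i k≡i = disj (here refl , here (sym k≡i))
  k≢j : k ≢ j
  k≢j k≡j = disj (there (here refl) , here (sym k≡j))
  l≢i : l ≢ i
  l≢i l≡i = disj (here refl , there (here (sym l≡i)))
  l≢j : l ≢ j
  l≢j l≡j = disj (there (here refl) , there (here (sym l≡j)))
  by-cases : Dec (a ≡ k) → Dec (a ≡ l) →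
             transpose i j (transpose k l a) ≡ transpose k l (transpose i j a)
  by-cases (yes refl) _ =
    trans (cong (transpose i j) (transpose-i a l))
      (trans (transpose-fixes l≢i l≢j)
        (sym (trans (cong (transpose a l) (transpose-fixes k≢i k≢j)) (transpose-i a l))))
  by-cases (no _) (yes refl) =
    trans (cong (transpose i j) (transpose-j k a))
      (trans (transpose-fixes k≢i k≢j)
        (sym (trans (cong (transpose k a) (transpose-fixes l≢i l≢j)) (transpose-j k a))))
  by-cases (no a≢k) (no a≢l) =
    trans (cong (transpose i j) (transpose-fixes a≢k a≢l))
      (sym (transpose-fixes (transpose-≢ k≢i k≢j a≢k) (transpose-≢ l≢i l≢j a≢l)))

data Generator : Set where
  flipPole   : ℕ → Bool → Generator
  swapBlocks : ℕ → ℕ → Generator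

moved : Generator → List ℕ
moved (flipPole m _)   = m ∷ []
moved (swapBlocks i j) = i ∷ j ∷ []

inPole : ℕ → Bool → Atom → Bool
inPole m p (a , q , _) = does (m ≟ a) ∧ does (p ≟ᵇ q)

act : Generator → Atom → Atom
act (flipPole m p)   x@(a , q , e) = a , q , inPole m p x xor e
act (swapBlocks i j) (a , q , e) = transpose i j a , q , e

xor-involutive : ∀ c e → c xor (c xor e) ≡ e
xor-involutive c e = trans (sym (xor-assoc c c e)) (cong (_xor e) (xor-same c))

xor-exchange : ∀ c d e → c xor (d xor e) ≡ d xor (c xor e)
xor-exchange c d e =
  trans (sym (xor-assoc c d e)) (trans (cong (_xor e) (xor-comm c d)) (xor-assoc d c e))

act-involutive : ∀ g x → act g (act g x) ≡ x
act-involutive (flipPole m p)   x@(a , q , e) = cong (λ e′ → a , q , e′) (xor-involutive (inPole m p x) e)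
act-involutive (swapBlocks i j) (a , q , e) = cong (λ a′ → a′ , q , e) (transpose-involutive i j a)

act-injective : ∀ g {x y} → act g x ≡ act g y → x ≡ y
act-injective g {x} {y} eq =
  trans (sym (act-involutive g x)) (trans (cong (act g) eq) (act-involutive g y))

act-fixes : ∀ g {x} → block x ∉ moved g → act g x ≡ x
act-fixes (flipPole m p)   {a , q , e} a∉ =
  cong (λ c → a , q , (c ∧ does (p ≟ᵇ q)) xor e) (dec-false (m ≟ a) (λ m≡a → a∉ (here (sym m≡a))))
act-fixes (swapBlocks i j) {a , q , e} a∉ =
  cong (λ a′ → a′ , q , e) (transpose-fixes (a∉ ∘ here) (a∉ ∘ there ∘ here))

act-partner : ∀ g x → act g (partner x) ≡ partner (act g x)
act-partner (flipPole m p)   x@(a , q , e) = cong (λ e′ → a , q , e′) (xor-not (inPole m p x) e)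
  where
  xor-not : ∀ c e → c xor not e ≡ not (c xor e)
  xor-not true  e = refl
  xor-not false e = refl
act-partner (swapBlocks i j) (a , q , e) = refl

act-flipPole-self : ∀ m p e → act (flipPole m p) (m , p , e) ≡ (m , p , not e)
act-flipPole-self m p e rewrite dec-true (m ≟ m) refl | dec-true (p ≟ᵇ p) refl = refl

act-flipPole-other : ∀ {m p} x → (m , p) ≢ (block x , pole x) → act (flipPole m p) x ≡ x
act-flipPole-other {m} {p} (a , q , e) ≢ with m ≟ a
... | no m≢a   = cong (λ c → a , q , (c ∧ does (p ≟ᵇ q)) xor e) (dec-false (m ≟ a) m≢a)
... | yes refl = cong (λ c → a , q , c xor e)
                   (trans (cong (does (m ≟ m) ∧_) (dec-false (p ≟ᵇ q) (≢ ∘ cong (m ,_)))) (∧-zeroʳ _))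

does-≟-transpose : ∀ {i j m} → Disjoint (m ∷ []) (i ∷ j ∷ []) →
                   ∀ a → does (m ≟ transpose i j a) ≡ does (m ≟ a)
does-≟-transpose {i} {j} {m} disj a = does-⇔ (mk⇔ forth back) (m ≟ transpose i j a) (m ≟ a)
  where
  fixes-m : transpose i j m ≡ m
  fixes-m = transpose-fixes (λ m≡i → disj (here refl , here m≡i))
                            (λ m≡j → disj (here refl , there (here m≡j)))
  forth : m ≡ transpose i j a → m ≡ a
  forth eq = transpose-injective i j (trans fixes-m eq)
  back : m ≡ a → m ≡ transpose i j a
  back refl = sym fixes-m

act-commute : ∀ g h → Disjoint (moved g) (moved h) → ∀ x → act g (act h x) ≡ act h (act g x)
act-commute (flipPole m p) (flipPole n r) _ x@(a , q , e) =
  cong (λ e′ → a , q , e′) (xor-exchange (inPole m p x) (inPole n r x) e)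
act-commute (flipPole m p) (swapBlocks i j) disj (a , q , e) =
  cong (λ c → transpose i j a , q , (c ∧ does (p ≟ᵇ q)) xor e)
    (does-≟-transpose disj a)
act-commute (swapBlocks i j) (flipPole m p) disj (a , q , e) =
  sym (act-commute (flipPole m p) (swapBlocks i j) (disjoint-sym disj) (a , q , e))
act-commute (swapBlocks i j) (swapBlocks k l) disj (a , q , e) =
  cong (λ a′ → a′ , q , e) (transpose-commute disj a)

map-act-involutive : ∀ g {n} (v : Vec Atom n) → map (act g) (map (act g) v) ≡ v
map-act-involutive g v =
  trans (sym (map-∘ (act g) (act g) v)) (trans (map-cong (act-involutive g) v) (map-id v))

map-act-commute : ∀ g h → Disjoint (moved g) (moved h) → ∀ {n} (v : Vec Atom n) →
                  map (act g) (map (act h) v) ≡ map (act h) (map (act g) v)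
map-act-commute g h disj v =
  trans (sym (map-∘ (act g) (act h) v)) (trans (map-cong (act-commute g h disj) v) (map-∘ (act h) (act g) v))

disjoint-⊆ʳ : ∀ {xs ys zs : List ℕ} → zs ⊆ ys → Disjoint xs ys → Disjoint xs zs
disjoint-⊆ʳ zs⊆ys disj (v∈xs , v∈zs) = disj (v∈xs , zs⊆ys v∈zs)

act-fixes-support : ∀ {K} g → Disjoint (moved g) K → ∀ {x} → block x ∈ K → act g x ≡ x
act-fixes-support g disj x∈K = act-fixes g (λ x∈g → disj (x∈g , x∈K))

same-pole : ∀ {x y} → (block x , pole x) ≡ (block y , pole y) → y ≡ x ⊎ y ≡ partner x
same-pole {m , p , true}  {.m , .p , true}  refl = inj₁ refl
same-pole {m , p , true}  {.m , .p , false} refl = inj₂ refl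
same-pole {m , p , false} {.m , .p , true}  refl = inj₂ refl
same-pole {m , p , false} {.m , .p , false} refl = inj₁ refl

partner-≢ : ∀ x → partner x ≢ x
partner-≢ (m , p , e) eq = not-¬ refl (sym (cong (proj₂ ∘ proj₂) eq))

block-act-∈ : ∀ {K} g → Disjoint (moved g) K → ∀ {x} → block (act g x) ∈ K → block x ∈ K
block-act-∈ {K} g disj {x} gx∈K =
  subst (λ z → block z ∈ K) (trans (sym (act-fixes-support g disj gx∈K)) (act-involutive g x)) gx∈K

Supported : List ℕ → {n : ℕ} → (Vec Atom n → Set) → Set
Supported K P = ∀ g → Disjoint (moved g) K → ∀ v → P (map (act g) v) → P v

module _ {K : List ℕ} {n : ℕ} {P : Vec Atom n → Set} where

  supported-forward : Supported K P → ∀ g → Disjoint (moved g) K → ∀ v → P v → P (map (act g) v)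
  supported-forward sup g disj v Pv = sup g disj (map (act g) v) (subst P (sym (map-act-involutive g v)) Pv)

  supported-⇔ : Supported K P → ∀ g → Disjoint (moved g) K → ∀ v → P (map (act g) v) ⇔ P v
  supported-⇔ sup g disj v = mk⇔ (sup g disj v) (supported-forward sup g disj v)

  supported-resp : ∀ {Q : Vec Atom n → Set} → (∀ v → P v ⇔ Q v) → Supported K P → Supported K Q
  supported-resp P⇔Q sup g disj v Qgv = to (P⇔Q v) (sup g disj v (from (P⇔Q (map (act g) v)) Qgv))

record Code (n : ℕ) : Set where
  field
    test      : Vec Atom n → Bool
    support   : List ℕ
    supported : Supported support (T ∘ test)

open Code

⟦_⟧ : ∀ {n} → Code n → Vec Atom n → Set
⟦ c ⟧ = T ∘ test c

decCode : ∀ {n} {P : Vec Atom n → Set} → Decidable P → (K : List ℕ) → Supported K P → Code n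
decCode P? K sup = record
  { test      = λ v → ⌊ P? v ⌋
  ; support   = K
  ; supported = λ g disj v t → fromWitness (sup g disj v (toWitness t))
  }

∅-code : ∀ {n} → Code n
∅-code = decCode {P = λ _ → ⊥} (λ _ → no (λ ())) [] (λ _ _ _ ())

translate : Generator → ∀ {n} → Code n → Code n
translate g c = record
  { test      = test c ∘ map (act g)
  ; support   = moved g ++ support c
  ; supported = λ h disj v t → supported c h (disjoint-⊆ʳ (∈-++⁺ʳ (moved g)) disj) (map (act g) v)
                  (subst ⟦ c ⟧ (map-act-commute g h (disjoint-sym (disjoint-⊆ʳ ∈-++⁺ˡ disj)) v) t)
  }

Admissible : (k : ℕ) → Pred Atom (suc k) → Set
Admissible k P = ¬ ¬ Σ (Code (suc k)) λ c → ∀ v → (¬ ¬ P v) ⇔ ⟦ c ⟧ v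

⟦⟧-admissible : ∀ {k} (c : Code (suc k)) → Admissible k ⟦ c ⟧
⟦⟧-admissible c ¬c = ¬c (c , λ v → mk⇔ (decidable-stable (T? (test c v))) (λ t ¬t → ¬t t))

frame : Frame
frame = record { D = Atom ; J = Admissible }

module _ {A B : Set} (_≟_ : DecidableEquality A) (default : B) where
  open import Data.List.Membership.DecPropositional _≟_ using (_∈?_)

  ¬¬-finite-choice : (L : List A) {Q : A → B → Set} → (∀ {a} → a ∈ L → ¬ ¬ Σ B (Q a)) →
                     ¬ ¬ Σ (A → B) λ c → ∀ {a} → a ∈ L → Q a (c a)
  ¬¬-finite-choice L {Q} choices = ¬¬-map choice-function (sequenceM 0ℓ ¬¬-Monad (tabulate choices))
    where
    choice-function : All (λ a → Σ B (Q a)) L → Σ (A → B) λ c → ∀ {a} → a ∈ L → Q a (c a)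
    choice-function chosen = (λ a → choose a (a ∈? L)) , λ {a} a∈L → choose-spec a∈L (a ∈? L)
      where
      choose : (a : A) → Dec (a ∈ L) → B
      choose a (yes a∈L) = proj₁ (lookupAll chosen a∈L)
      choose a (no _)    = default
      choose-spec : ∀ {a} → a ∈ L → (a∈?L : Dec (a ∈ L)) → Q a (choose a a∈?L)
      choose-spec _   (yes a∈L) = proj₂ (lookupAll chosen a∈L)
      choose-spec a∈L (no a∉L)  = contradiction a∈L a∉L

fresh : List ℕ → ℕ
fresh K = suc (max 0 K)

fresh-∉ : ∀ K → fresh K ∉ K
fresh-∉ K fresh∈K = 1+n≰n (lookupAll (xs≤max 0 K) fresh∈K)

bools : List Bool
bools = true ∷ false ∷ []

∈-bools : ∀ b → b ∈ bools
∈-bools true  = here refl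
∈-bools false = there (here refl)

atomsOf : List ℕ → List Atom
atomsOf K = cartesianProduct K (cartesianProduct bools bools)

∈-atomsOf⁺ : ∀ {K x} → block x ∈ K → x ∈ atomsOf K
∈-atomsOf⁺ {x = _ , p , e} m∈K =
  ∈-cartesianProduct⁺ m∈K (∈-cartesianProduct⁺ (∈-bools p) (∈-bools e))

∈-atomsOf⁻ : ∀ {K x} → x ∈ atomsOf K → block x ∈ K
∈-atomsOf⁻ {K} x∈ = proj₁ (∈-cartesianProduct⁻ K (cartesianProduct bools bools) x∈)

Boolable : ∀ {n} → (Vec Atom n → Set) → Set
Boolable {n} P = Σ (Vec Atom n → Bool) λ b → ∀ v → (¬ ¬ P v) ⇔ T (b v)

-- Up to a symmetry fixing K (a block exchange), every atom lies in K or in one fresh block f,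
-- so P is determined by its sections at the finitely many atoms of f ∷ K.
boolable : ∀ n (K : List ℕ) (P : Vec Atom n → Set) → Supported K (¬_ ∘ ¬_ ∘ P) → ¬ ¬ Boolable P
boolable zero K P _ = ¬¬-map decided ¬¬-excluded-middle
  where
  decided : Dec (P []) → Boolable P
  decided (yes p) = (λ _ → true)  , λ { [] → mk⇔ _ (λ _ ¬p → ¬p p) }
  decided (no ¬p) = (λ _ → false) , λ { [] → mk⇔ (λ ¬¬p → ¬¬p ¬p) (λ ()) }
boolable (suc n) K P sup = ¬¬-map glue (¬¬-finite-choice _≟ₐ_ (λ _ → false) (atomsOf K⁺) sections)
  where
  f  = fresh K
  K⁺ = f ∷ K

  section-supported : ∀ {a} → block a ∈ K⁺ → Supported K⁺ (λ w → ¬ ¬ P (a ∷ w))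
  section-supported {a} a∈K⁺ g disj w =
    sup g (disjoint-⊆ʳ there disj) (a ∷ w)
      ∘ subst (λ a′ → ¬ ¬ P (a′ ∷ map (act g) w)) (sym (act-fixes-support g disj a∈K⁺))

  sections : ∀ {a} → a ∈ atomsOf K⁺ → ¬ ¬ Boolable (λ w → P (a ∷ w))
  sections {a} a∈ = boolable n K⁺ (λ w → P (a ∷ w)) (section-supported (∈-atomsOf⁻ a∈))

  to-fresh : Atom → Generator
  to-fresh a = swapBlocks (block a) f

  to-fresh-lands : ∀ a → act (to-fresh a) a ∈ atomsOf K⁺
  to-fresh-lands (m , _ , _) = ∈-atomsOf⁺ (subst (_∈ K⁺) (sym (transpose-i m f)) (here refl))

  to-fresh-disjoint : ∀ a → block a ∉ K → Disjoint (moved (to-fresh a)) K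
  to-fresh-disjoint _ a∉K (here refl , a∈K)         = a∉K a∈K
  to-fresh-disjoint _ a∉K (there (here refl) , f∈K) = fresh-∉ K f∈K

  glue : Σ (Atom → Vec Atom n → Bool) (λ c → ∀ {a} → a ∈ atomsOf K⁺ → ∀ w → (¬ ¬ P (a ∷ w)) ⇔ T (c a w))
         → Boolable P
  glue (c , c-spec) = (λ { (a ∷ w) → decide a (block a ∈? K) w })
                    , (λ { (a ∷ w) → decide-spec a (block a ∈? K) w })
    where
    open import Data.List.Membership.DecPropositional _≟_ using (_∈?_)
    decide : (a : Atom) → Dec (block a ∈ K) → Vec Atom n → Bool
    decide a (yes _) w = c a w
    decide a (no _)  w = c (act (to-fresh a) a) (map (act (to-fresh a)) w)
    decide-spec : ∀ a (a∈?K : Dec (block a ∈ K)) w → (¬ ¬ P (a ∷ w)) ⇔ T (decide a a∈?K w)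
    decide-spec a (yes a∈K) w = c-spec (∈-atomsOf⁺ (there a∈K)) w
    decide-spec a (no a∉K)  w =
      ⇔-trans (⇔-sym (supported-⇔ sup (to-fresh a) (to-fresh-disjoint a a∉K) (a ∷ w)))
        (c-spec (to-fresh-lands a) _)

supported⇒admissible : ∀ {k} {P : Pred Atom (suc k)} →
                       ¬ ¬ Σ (List ℕ) (λ K → Supported K (¬_ ∘ ¬_ ∘ P)) → Admissible k P
supported⇒admissible {k} {P} finitely-supported =
  finitely-supported >>= λ (K , sup) →
  ¬¬-map (λ (b , b-spec) → code K sup b b-spec , b-spec) (boolable (suc k) K P sup)
  where
  code : ∀ K → Supported K (¬_ ∘ ¬_ ∘ P) → (b : Vec Atom (suc k) → Bool) → (∀ v → (¬ ¬ P v) ⇔ T (b v)) →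
         Code (suc k)
  code K sup b b-spec = record { test = b ; support = K ; supported = supported-resp b-spec sup }

admissible⇒supported : ∀ {k} {P : Pred Atom (suc k)} → Admissible k P →
                       ¬ ¬ Σ (List ℕ) λ K → Supported K (¬_ ∘ ¬_ ∘ P)
admissible⇒supported = ¬¬-map λ (c , c-spec) → support c , supported-resp (⇔-sym ∘ c-spec) (supported c)

-- All occurrences, bound ones included: any finite superset of the free variables will do.
varsᵢ : Form → List ℕ
varsᵢ (x ≐ y)       = x ∷ y ∷ []
varsᵢ (app _ _ xs)  = toList xs
varsᵢ (¬ᶠ φ)        = varsᵢ φ
varsᵢ (φ ∧ᶠ ψ)      = varsᵢ φ ++ varsᵢ ψ
varsᵢ (∀ᵢ _ φ)      = varsᵢ φ
varsᵢ (∀ₚ _ _ φ)    = varsᵢ φ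

varsₚ : Form → List (ℕ × ℕ)
varsₚ (_ ≐ _)       = []
varsₚ (app k X _)   = (k , X) ∷ []
varsₚ (¬ᶠ φ)        = varsₚ φ
varsₚ (φ ∧ᶠ ψ)      = varsₚ φ ++ varsₚ ψ
varsₚ (∀ᵢ _ φ)      = varsₚ φ
varsₚ (∀ₚ _ _ φ)    = varsₚ φ

-- Satisfaction with predicate quantifiers ranging over codes: unlike sat frame it lands in Set,
-- so that the relations it defines are predicates on atoms.
_⊨_ : Asg Atom → Form → Set
s ⊨ (x ≐ y)      = ¬ ¬ (ind s x ≡ ind s y)
s ⊨ app k X xs   = ¬ ¬ pred s k X (map (ind s) xs)
s ⊨ ¬ᶠ φ         = ¬ (s ⊨ φ)
s ⊨ (φ ∧ᶠ ψ)     = s ⊨ φ × s ⊨ ψ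
s ⊨ ∀ᵢ x φ       = (a : Atom) → setI s x a ⊨ φ
s ⊨ ∀ₚ k X φ     = (c : Code (suc k)) → setP s k X ⟦ c ⟧ ⊨ φ

⊨-stable : ∀ φ s → Stable (s ⊨ φ)
⊨-stable (x ≐ y)      s ¬¬h ¬eq = ¬¬h (λ h → h ¬eq)
⊨-stable (app k X xs) s ¬¬h ¬P  = ¬¬h (λ h → h ¬P)
⊨-stable (¬ᶠ φ)       s ¬¬h h   = ¬¬h (λ ¬h → ¬h h)
⊨-stable (φ ∧ᶠ ψ)     s ¬¬h     = ⊨-stable φ s (¬¬-map proj₁ ¬¬h) , ⊨-stable ψ s (¬¬-map proj₂ ¬¬h)
⊨-stable (∀ᵢ x φ)     s ¬¬h a   = ⊨-stable φ (setI s x a) (¬¬-map (λ h → h a) ¬¬h)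
⊨-stable (∀ₚ k X φ)   s ¬¬h c   = ⊨-stable φ (setP s k X ⟦ c ⟧) (¬¬-map (λ h → h c) ¬¬h)

updI-same : ∀ {A : Set} (f : ℕ → A) x a → updI f x a x ≡ a
updI-same f x a with x ≟ x
... | yes _   = refl
... | no x≢x = contradiction refl x≢x

updI-other : ∀ {A : Set} (f : ℕ → A) {x y} a → x ≢ y → updI f x a y ≡ f y
updI-other f {x} {y} a x≢y with x ≟ y
... | yes x≡y = contradiction x≡y x≢y
... | no _    = refl

setP-same : ∀ (s : Asg Atom) k X P → pred (setP s k X P) k X ≡ P
setP-same s k X P with k ≟ k | X ≟ X
... | yes refl | yes _   = refl
... | yes refl | no X≢X = contradiction refl X≢X
... | no k≢k   | _       = contradiction refl k≢k

setP-other : ∀ (s : Asg Atom) {k X k′ Y} P → (k , X) ≢ (k′ , Y) → pred (setP s k X P) k′ Y ≡ pred s k′ Y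
setP-other s {k} {X} {k′} {Y} P ≢ with k ≟ k′ | X ≟ Y
... | yes refl | yes refl = contradiction refl ≢
... | yes refl | no _     = refl
... | no _     | _        = refl

valid-setP : ∀ (s : Asg Atom) k X {P} → Valid frame s → Admissible k P → Valid frame (setP s k X P)
valid-setP s k X valid P-adm k′ Y with k ≟ k′ | X ≟ Y
... | yes refl | yes _ = P-adm
... | yes refl | no _  = valid k′ Y
... | no _     | _     = valid k′ Y

valid-setVec : ∀ {s : Asg Atom} {n} (xs : Vec ℕ n) v → Valid frame s → Valid frame (setVec s xs v)
valid-setVec []       []      valid = valid
valid-setVec (x ∷ xs) (a ∷ v) valid = valid-setVec xs v valid

module Transport (f : Atom → Atom) (f-involutive : ∀ x → f (f x) ≡ x)
                 (transport : ∀ {n} → Code n → Code n)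
                 (transport-test : ∀ {n} (c : Code n) v → test (transport c) v ≡ test c (map f v)) where

  record Agree (Vᵢ : List ℕ) (Vₚ : List (ℕ × ℕ)) (s t : Asg Atom) : Set where
    constructor agree
    field
      on-ind  : ∀ {y} → y ∈ Vᵢ → ind t y ≡ f (ind s y)
      on-pred : ∀ {k X} → (k , X) ∈ Vₚ → ∀ v → (¬ ¬ pred t k X (map f v)) ⇔ (¬ ¬ pred s k X v)

  open Agree

  f-injective : ∀ {x y} → f x ≡ f y → x ≡ y
  f-injective {x} {y} eq = trans (sym (f-involutive x)) (trans (cong f eq) (f-involutive y))

  agree-⊆ : ∀ {Vᵢ Vᵢ′ Vₚ Vₚ′ s t} → Vᵢ ⊆ Vᵢ′ → Vₚ ⊆ Vₚ′ → Agree Vᵢ′ Vₚ′ s t → Agree Vᵢ Vₚ s t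
  agree-⊆ ⊆ᵢ ⊆ₚ (agree on-ind on-pred) = agree (on-ind ∘ ⊆ᵢ) (on-pred ∘ ⊆ₚ)

  agree-setI : ∀ {Vᵢ Vₚ s t} x {a b} → b ≡ f a → Agree Vᵢ Vₚ s t → Agree Vᵢ Vₚ (setI s x a) (setI t x b)
  agree-setI {s = s} {t} x {a} {b} b≡fa ag = agree (λ {y} y∈V → by-cases y∈V (x ≟ y)) (on-pred ag)
    where
    by-cases : ∀ {y} → y ∈ _ → Dec (x ≡ y) → updI (ind t) x b y ≡ f (updI (ind s) x a y)
    by-cases _   (yes refl) = trans (updI-same (ind t) x b) (trans b≡fa (cong f (sym (updI-same (ind s) x a))))
    by-cases y∈V (no x≢y)   =
      trans (updI-other (ind t) b x≢y) (trans (on-ind ag y∈V) (cong f (sym (updI-other (ind s) a x≢y))))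

  agree-setP : ∀ {Vᵢ Vₚ s t} k X {P Q} → (∀ v → (¬ ¬ Q (map f v)) ⇔ (¬ ¬ P v)) →
               Agree Vᵢ Vₚ s t → Agree Vᵢ Vₚ (setP s k X P) (setP t k X Q)
  agree-setP {s = s} {t} k X {P} {Q} Q⇔P ag =
    agree (on-ind ag) (λ {k′} {Y} kY∈V → by-cases kY∈V ((k , X) ≟ₚ (k′ , Y)))
    where
    _≟ₚ_ = ≡-dec _≟_ _≟_
    by-cases : ∀ {k′ Y} → (k′ , Y) ∈ _ → Dec ((k , X) ≡ (k′ , Y)) →
               ∀ v → (¬ ¬ pred (setP t k X Q) k′ Y (map f v)) ⇔ (¬ ¬ pred (setP s k X P) k′ Y v)
    by-cases _ (yes refl) rewrite setP-same s k X P | setP-same t k X Q = Q⇔P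
    by-cases kY∈V (no ≢)  rewrite setP-other s P ≢ | setP-other t Q ≢   = on-pred ag kY∈V

  agree-setVec : ∀ {Vᵢ Vₚ s t n} (xs : Vec ℕ n) w → Agree Vᵢ Vₚ s t →
                 Agree Vᵢ Vₚ (setVec s xs w) (setVec t xs (map f w))
  agree-setVec []       []      ag = ag
  agree-setVec (x ∷ xs) (a ∷ w) ag = agree-setI x refl (agree-setVec xs w ag)

  map-agree : ∀ {s t n Vₚ} (xs : Vec ℕ n) → Agree (toList xs) Vₚ s t → map (ind t) xs ≡ map f (map (ind s) xs)
  map-agree []       ag = refl
  map-agree (x ∷ xs) ag = cong₂ _∷_ (on-ind ag (here refl)) (map-agree xs (agree-⊆ there (λ p → p) ag))

  ⊨-transport : ∀ φ {s t} → Agree (varsᵢ φ) (varsₚ φ) s t → (s ⊨ φ) ⇔ (t ⊨ φ)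
  ⊨-transport (x ≐ y) ag =
    mk⇔ (¬¬-map λ eq → trans tx (trans (cong f eq) (sym ty)))
        (¬¬-map λ eq → f-injective (trans (sym tx) (trans eq ty)))
    where
    tx = on-ind ag (here refl)
    ty = on-ind ag (there (here refl))
  ⊨-transport (app k X xs) {s} {t} ag =
    subst (λ u → (s ⊨ app k X xs) ⇔ (¬ ¬ pred t k X u)) (sym (map-agree xs ag))
      (⇔-sym (on-pred ag (here refl) (map (ind s) xs)))
  ⊨-transport (¬ᶠ φ) ag = ¬-cong-⇔ (⊨-transport φ ag)
  ⊨-transport (φ ∧ᶠ ψ) ag =
    ⊨-transport φ (agree-⊆ ∈-++⁺ˡ ∈-++⁺ˡ ag) ×-⇔ ⊨-transport ψ (agree-⊆ (∈-++⁺ʳ _) (∈-++⁺ʳ _) ag)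
  ⊨-transport (∀ᵢ x φ) ag =
    mk⇔ (λ h b → to (⊨-transport φ (agree-setI x (sym (f-involutive b)) ag)) (h (f b)))
        (λ h a → from (⊨-transport φ (agree-setI x refl ag)) (h (f a)))
  ⊨-transport (∀ₚ k X φ) ag =
    mk⇔ (λ h c → to (⊨-transport φ (agree-setP k X (λ v → ≡⇒¬¬T⇔ (sym (transport-test c v))) ag))
                    (h (transport c)))
        (λ h c → from (⊨-transport φ (agree-setP k X (λ v → ≡⇒¬¬T⇔ (transport-back c v)) ag))
                    (h (transport c)))
    where
    ≡⇒¬¬T⇔ : ∀ {b b′} → b ≡ b′ → (¬ ¬ T b) ⇔ (¬ ¬ T b′)
    ≡⇒¬¬T⇔ refl = mk⇔ (λ t → t) (λ t → t)
    map-involutive : ∀ {n} (v : Vec Atom n) → map f (map f v) ≡ v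
    map-involutive v = trans (sym (map-∘ f f v)) (trans (map-cong f-involutive v) (map-id v))
    transport-back : ∀ {n} (c : Code n) v → test (transport c) (map f v) ≡ test c v
    transport-back c v = trans (transport-test c (map f v)) (cong (test c) (map-involutive v))

module Unchanged = Transport (λ x → x) (λ _ → refl) (λ c → c) (λ c v → cong (test c) (sym (map-id v)))
module Along (g : Generator) = Transport (act g) (act-involutive g) (translate g) (λ _ _ → refl)

unchanged-except : ∀ {Vᵢ Vₚ} s k X {P Q : Pred Atom (suc k)} → (∀ v → (¬ ¬ Q v) ⇔ (¬ ¬ P v)) →
                   Unchanged.Agree Vᵢ Vₚ (setP s k X P) (setP s k X Q)
unchanged-except s k X {Q = Q} Q⇔P =
  Unchanged.agree-setP k X (λ v → ⇔-trans (map-id-⇔ Q v) (Q⇔P v))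
    (Unchanged.agree (λ _ → refl) (λ {k′} {Y} _ → map-id-⇔ (pred s k′ Y)))
  where
  map-id-⇔ : ∀ {n} (R : Vec Atom n → Set) v → (¬ ¬ R (map (λ x → x) v)) ⇔ (¬ ¬ R v)
  map-id-⇔ R v = subst (λ u → (¬ ¬ R u) ⇔ (¬ ¬ R v)) (sym (map-id v)) (mk⇔ (λ r → r) (λ r → r))

sat⇔⊨ : ∀ φ {s} → Valid frame s → sat frame s φ ⇔ s ⊨ φ
sat⇔⊨ (x ≐ y)      valid = mk⇔ lower lift
sat⇔⊨ (app k X xs) valid = mk⇔ lower lift
sat⇔⊨ (¬ᶠ φ)       valid = ¬-cong-⇔ (sat⇔⊨ φ valid)
sat⇔⊨ (φ ∧ᶠ ψ)     valid = sat⇔⊨ φ valid ×-⇔ sat⇔⊨ ψ valid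
sat⇔⊨ (∀ᵢ x φ)     valid = mk⇔ (λ h a → to (sat⇔⊨ φ valid) (h a)) (λ h a → from (sat⇔⊨ φ valid) (h a))
sat⇔⊨ (∀ₚ k X φ) {s} valid = mk⇔ (λ h c → to (sat⇔⊨ φ (valid-c c)) (h ⟦ c ⟧ (⟦⟧-admissible c))) from-codes
  where
  valid-c : (c : Code (suc k)) → Valid frame (setP s k X ⟦ c ⟧)
  valid-c c = valid-setP s k X valid (⟦⟧-admissible c)
  ⟦⟧-stable : (c : Code (suc k)) → ∀ v → (¬ ¬ ⟦ c ⟧ v) ⇔ ⟦ c ⟧ v
  ⟦⟧-stable c v = mk⇔ (decidable-stable (T? (test c v))) (λ t ¬t → ¬t t)
  from-codes : s ⊨ ∀ₚ k X φ → sat frame s (∀ₚ k X φ)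
  from-codes h P P-adm = from (sat⇔⊨ φ (valid-setP s k X valid P-adm)) (⊨-stable φ _ (¬¬-map from-code P-adm))
    where
    from-code : Σ (Code (suc k)) (λ c → ∀ v → (¬ ¬ P v) ⇔ ⟦ c ⟧ v) → setP s k X P ⊨ φ
    from-code (c , c-spec) = to (Unchanged.⊨-transport φ (unchanged-except s k X P⇔c)) (h c)
      where
      P⇔c : ∀ v → (¬ ¬ P v) ⇔ (¬ ¬ ⟦ c ⟧ v)
      P⇔c v = ⇔-trans (c-spec v) (⇔-sym (⟦⟧-stable c v))

definable-supported : ∀ φ {n} (xs : Vec ℕ n) {s} → Valid frame s →
                      ¬ ¬ Σ (List ℕ) λ K → Supported K (λ v → ¬ ¬ (setVec s xs v ⊨ φ))
definable-supported φ xs {s} valid =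
  ¬¬-map supports
    (¬¬-finite-choice (≡-dec _≟_ _≟_) [] (varsₚ φ) (λ {(k , X)} _ → admissible⇒supported (valid k X)))
  where
  ParameterSupports : (ℕ × ℕ → List ℕ) → Set
  ParameterSupports supp =
    ∀ {kX} → kX ∈ varsₚ φ → Supported (supp kX) (¬_ ∘ ¬_ ∘ pred s (proj₁ kX) (proj₂ kX))
  supports : Σ (ℕ × ℕ → List ℕ) ParameterSupports →
             Σ (List ℕ) λ K → Supported K (λ v → ¬ ¬ (setVec s xs v ⊨ φ))
  supports (supp , supp-spec) = K , λ g disj v → ¬¬-map (to (Along.⊨-transport g φ (agreement g disj v)))
    where
    K = List.map (block ∘ ind s) (varsᵢ φ) ++ concatMap supp (varsₚ φ)
    agreement : ∀ g → Disjoint (moved g) K → ∀ v →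
                Along.Agree g (varsᵢ φ) (varsₚ φ) (setVec s xs (map (act g) v)) (setVec s xs v)
    agreement g disj v =
      subst (Along.Agree g (varsᵢ φ) (varsₚ φ) (setVec s xs (map (act g) v)) ∘ setVec s xs)
        (map-act-involutive g v) (Along.agree-setVec g xs (map (act g) v) (Along.agree on-ind on-pred))
      where
      on-ind : ∀ {y} → y ∈ varsᵢ φ → ind s y ≡ act g (ind s y)
      on-ind y∈ = sym (act-fixes-support g (disjoint-⊆ʳ ∈-++⁺ˡ disj) (∈-map⁺ (block ∘ ind s) y∈))
      on-pred : ∀ {k X} → (k , X) ∈ varsₚ φ → ∀ w → (¬ ¬ pred s k X (map (act g) w)) ⇔ (¬ ¬ pred s k X w)
      on-pred kX∈ = supported-⇔ (supp-spec kX∈) g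
        (disjoint-⊆ʳ (λ i∈ → ∈-++⁺ʳ _ (∈-concat⁺′ i∈ (∈-map⁺ supp kX∈))) disj)

comprehension : (φ : Form) (k : ℕ) (xs : Vec ℕ (suc k)) (s : Asg Atom) → Valid frame s →
                Σ (Pred Atom (suc k)) λ P → Admissible k P ×
                  ((v : Vec Atom (suc k)) → (¬ ¬ P v) ⇔c sat frame (setVec s xs v) φ)
comprehension φ k xs s valid = (λ v → setVec s xs v ⊨ φ) , supported⇒admissible (definable-supported φ xs valid) ,
  λ v → (from (sat⇔⊨ φ (valid-at v)) ∘ ⊨-stable φ _) , (λ h ¬h → ¬h (to (sat⇔⊨ φ (valid-at v)) h))
  where
  valid-at : ∀ v → Valid frame (setVec s xs v)
  valid-at v = valid-setVec xs v valid

model : HenkinStructure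
model = record
  { frame         = frame
  ; inhabited     = 0 , false , false
  ; nonemptyJ     = λ k → ⟦ ∅-code ⟧ , ⟦⟧-admissible ∅-code
  ; comprehension = comprehension
  }

module RussellAsser {A : Pred Atom 1} {R : Pred Atom 2} (a : Code 1) (r : Code 2)
                    (A⇔a : ∀ v → (¬ ¬ A v) ⇔ ⟦ a ⟧ v) (R⇔r : ∀ v → (¬ ¬ R v) ⇔ ⟦ r ⟧ v) where

  K : List ℕ
  K = support a ++ support r

  Domain : Set
  Domain = (x : Atom) → at1 frame A x ⇔c ∃c (λ y → at2 frame R x y)

  FibresDisjoint : Set
  FibresDisjoint = (x₁ x₂ : Atom) → at1 frame A x₁ → at1 frame A x₂ → ¬ (_≈_ frame x₁ x₂) →
                   ¬ ∃c (λ y → at2 frame R x₁ y × at2 frame R x₂ y)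

  -- Flipping the pole of x moves x to its partner and fixes every atom outside that pole,
  -- so a third atom in the fibre of x would also lie in the fibre of its partner.
  fibre-outside-support : FibresDisjoint → ∀ {x y} → block x ∉ K → at1 frame A x → at2 frame R x y →
                          y ≢ x → y ≢ partner x → ⊥
  fibre-outside-support disjoint {x@(m , p , e)} {y} x∉K Ax Rxy y≢x y≢x′ =
    disjoint x (partner x) Ax A-partner (λ ¬¬x≡x′ → ¬¬x≡x′ (partner-≢ x ∘ sym)) (λ k → k y (Rxy , R-partner))
    where
    g = flipPole m p
    g-disjoint : Disjoint (moved g) K
    g-disjoint (here refl , m∈K) = x∉K m∈K
    gx : act g x ≡ partner x
    gx = act-flipPole-self m p e
    gy : act g y ≡ y
    gy = act-flipPole-other y λ eq → [ y≢x , y≢x′ ] (same-pole eq)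
    A-partner : at1 frame A (partner x)
    A-partner = from (A⇔a _) (subst (λ z → ⟦ a ⟧ (z ∷ [])) gx
                  (supported-forward (supported a) g (disjoint-⊆ʳ ∈-++⁺ˡ g-disjoint) (x ∷ []) (to (A⇔a _) Ax)))
    R-partner : at2 frame R (partner x) y
    R-partner = from (R⇔r _) (subst₂ (λ z w → ⟦ r ⟧ (z ∷ w ∷ [])) gx gy
                  (supported-forward (supported r) g (disjoint-⊆ʳ (∈-++⁺ʳ _) g-disjoint) (x ∷ y ∷ [])
                    (to (R⇔r _) Rxy)))

  ImageChoice : (Atom → Atom) → Set
  ImageChoice ch = ∀ {x} → x ∈ atomsOf K → Σ Atom (λ y → ⟦ r ⟧ (x ∷ y ∷ [])) → ⟦ r ⟧ (x ∷ ch x ∷ [])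

  ¬¬-image-choice : ¬ ¬ Σ (Atom → Atom) ImageChoice
  ¬¬-image-choice = ¬¬-finite-choice _≟ₐ_ x₀ (atomsOf K) (λ _ → independence-of-premise x₀ (λ image → image))
    where
    x₀ : Atom
    x₀ = 0 , false , false

  module Selector (ch : Atom → Atom) (ch-spec : ImageChoice ch) where
    open import Data.List.Membership.DecPropositional _≟_ using (_∈?_)

    pick : (x : Atom) → Dec (⟦ r ⟧ (x ∷ x ∷ [])) → Atom
    pick x (yes _) = x
    pick x (no _)  = partner x

    -- Outside K the fibre of x lies in {x , partner x} (fibre-outside-support).
    target′ : (x : Atom) → Dec (block x ∈ K) → Atom
    target′ x (yes _) = ch x
    target′ x (no _)  = pick x (T? (test r (x ∷ x ∷ [])))

    target : Atom → Atom
    target x = target′ x (block x ∈? K)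

    Kₛ : List ℕ
    Kₛ = K ++ List.map (block ∘ ch) (atomsOf K)

    module _ (g : Generator) (disj : Disjoint (moved g) Kₛ) where

      disj-K : Disjoint (moved g) K
      disj-K = disjoint-⊆ʳ ∈-++⁺ˡ disj

      disj-r : Disjoint (moved g) (support r)
      disj-r = disjoint-⊆ʳ (∈-++⁺ʳ _) disj-K

      pick-equivariant : ∀ x d d′ → pick (act g x) d′ ≡ act g (pick x d)
      pick-equivariant x (yes _)   (yes _)   = refl
      pick-equivariant x (no _)    (no _)    = sym (act-partner g x)
      pick-equivariant x (no ¬rxx) (yes rgx) = contradiction (supported r g disj-r (x ∷ x ∷ []) rgx) ¬rxx
      pick-equivariant x (yes rxx) (no ¬rgx) =
        contradiction (supported-forward (supported r) g disj-r (x ∷ x ∷ []) rxx) ¬rgx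

      target′-equivariant : ∀ x d d′ → target′ (act g x) d′ ≡ act g (target′ x d)
      target′-equivariant x (yes x∈K) (yes _) =
        trans (cong ch (act-fixes-support g disj-K x∈K))
          (sym (act-fixes-support g disj (∈-++⁺ʳ K (∈-map⁺ (block ∘ ch) (∈-atomsOf⁺ x∈K)))))
      target′-equivariant x (no _)    (no _)  = pick-equivariant x _ _
      target′-equivariant x (yes x∈K) (no gx∉K) =
        contradiction (subst (λ z → block z ∈ K) (sym (act-fixes-support g disj-K x∈K)) x∈K) gx∉K
      target′-equivariant x (no x∉K)  (yes gx∈K) = contradiction (block-act-∈ g disj-K gx∈K) x∉K

      target-equivariant : ∀ x → target (act g x) ≡ act g (target x)
      target-equivariant x = target′-equivariant x (block x ∈? K) (block (act g x) ∈? K)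

    IsTarget : Vec Atom 2 → Set
    IsTarget (x ∷ y ∷ []) = y ≡ target x

    selector : Code 2
    selector = decCode {P = IsTarget} (λ { (x ∷ y ∷ []) → y ≟ₐ target x }) Kₛ
      λ { g disj (x ∷ y ∷ []) gy≡ → act-injective g (trans gy≡ (target-equivariant g disj x)) }

    target-in-fibre : Domain → FibresDisjoint → ∀ x → at1 frame A x → at2 frame R x (target x)
    target-in-fibre domain disjoint x Ax = by-cases (block x ∈? K)
      where
      image : ∃c (λ y → at2 frame R x y)
      image = proj₁ (domain x) Ax
      pick-in-fibre : block x ∉ K → (d : Dec (⟦ r ⟧ (x ∷ x ∷ []))) → at2 frame R x (pick x d)
      pick-in-fibre x∉K (yes rxx) = from (R⇔r _) rxx
      pick-in-fibre x∉K (no ¬rxx) ¬R = image λ y Rxy → by-atom y Rxy (y ≟ₐ x) (y ≟ₐ partner x)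
        where
        by-atom : ∀ y → at2 frame R x y → Dec (y ≡ x) → Dec (y ≡ partner x) → ⊥
        by-atom y Rxy (yes refl) _          = ¬rxx (to (R⇔r _) Rxy)
        by-atom y Rxy (no _)     (yes refl) = Rxy ¬R
        by-atom y Rxy (no y≢x)   (no y≢x′)  = fibre-outside-support disjoint x∉K Ax Rxy y≢x y≢x′
      by-cases : (d : Dec (block x ∈ K)) → at2 frame R x (target′ x d)
      by-cases (yes x∈K) ¬R =
        image λ y Rxy → from (R⇔r _) (ch-spec (∈-atomsOf⁺ x∈K) (y , to (R⇔r _) Rxy)) ¬R
      by-cases (no x∉K)     = pick-in-fibre x∉K (T? (test r (x ∷ x ∷ [])))

    unique-selection : Domain → FibresDisjoint → ∀ x → at1 frame A x →
                       ∃!! frame (λ y → at2 frame R x y × at2 frame ⟦ selector ⟧ x y)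
    unique-selection domain disjoint x Ax k =
      k (target x) ((target-in-fibre domain disjoint x Ax , λ ¬S → ¬S (fromWitness refl)) ,
                    λ z (_ , Sxz) → ¬¬-map toWitness Sxz)

ac11 : AC11 frame
ac11 A A-adm R R-adm ¬selection =
  A-adm λ (a , A⇔a) → R-adm λ (r , R⇔r) →
  let open RussellAsser a r A⇔a R⇔r in
  ¬¬-image-choice λ (ch , ch-spec) →
  let open Selector ch ch-spec in
  ¬selection (⟦ selector ⟧ , ⟦⟧-admissible selector) (λ (domain , disjoint) → unique-selection domain disjoint)

Opposite : Atom → Atom → Set
Opposite x y = block x ≡ block y × pole x ≢ pole y

opposite? : ∀ x y → Dec (Opposite x y)
opposite? x y = (block x ≟ block y) ×-dec ¬? (pole x ≟ᵇ pole y)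

opposite-invariant : ∀ g {x y} → Opposite (act g x) (act g y) → Opposite x y
opposite-invariant (flipPole m p)   (same-block , other-pole) = same-block , other-pole
opposite-invariant (swapBlocks i j) (same-block , other-pole) = transpose-injective i j same-block , other-pole

opposite-code : Code 2
opposite-code = decCode {P = λ { (x ∷ y ∷ []) → Opposite x y }} (λ { (x ∷ y ∷ []) → opposite? x y }) []
  λ { g _ (x ∷ y ∷ []) → opposite-invariant g }

opposite-of : Atom → Atom
opposite-of (m , p , _) = m , not p , false

opposite-of-opposite : ∀ x → Opposite x (opposite-of x)
opposite-of-opposite x = refl , not-¬ refl

fresh-atom : List ℕ → Atom
fresh-atom K = fresh K , false , false

-- Flipping the pole of the fresh block opposite to the fresh atom fixes the atom and the code
-- but exchanges the two atoms of that pole.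
partner-closed-at-fresh-atom : (c : Code 2) → let x = fresh-atom (support c) in
                               ∀ {y} → Opposite x y → ⟦ c ⟧ (x ∷ y ∷ []) → ⟦ c ⟧ (x ∷ partner y ∷ [])
partner-closed-at-fresh-atom c {y@(.(fresh (support c)) , q , e)} (refl , false≢q) =
  supported c g g-disjoint (x ∷ partner y ∷ []) ∘ subst₂ (λ u w → ⟦ c ⟧ (u ∷ w ∷ [])) (sym gx) (sym gy)
  where
  x = fresh-atom (support c)
  g = flipPole (fresh (support c)) q
  g-disjoint : Disjoint (moved g) (support c)
  g-disjoint (here refl , f∈c) = fresh-∉ (support c) f∈c
  gx : act g x ≡ x
  gx = act-flipPole-other {fresh (support c)} {q} x (false≢q ∘ sym ∘ cong proj₂)
  gy : act g (partner y) ≡ y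
  gy = trans (act-flipPole-self (fresh (support c)) q (not e))
             (cong (λ e′ → fresh (support c) , q , e′) (not-involutive e))

PartnerClosedOpposite : Pred Atom 2 → Atom → Set
PartnerClosedOpposite S x = ∀ {y} → Opposite x y → at2 frame S x y → at2 frame S x (partner y)

partner-closed-atom : ∀ {S} → Admissible 1 S → ¬ ¬ Σ Atom (PartnerClosedOpposite S)
partner-closed-atom = ¬¬-map λ (c , S⇔c) →
  fresh-atom (support c) , λ opp Sxy → from (S⇔c _) (partner-closed-at-fresh-atom c opp (to (S⇔c _) Sxy))

∃ᶠ : ℕ → Form → Form
∃ᶠ x φ = ¬ᶠ (∀ᵢ x (¬ᶠ φ))

_⇒ᶠ_ : Form → Form → Form
φ ⇒ᶠ ψ = ¬ᶠ (φ ∧ᶠ ¬ᶠ ψ)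

_⇔ᶠ_ : Form → Form → Form
φ ⇔ᶠ ψ = (φ ⇒ᶠ ψ) ∧ᶠ (ψ ⇒ᶠ φ)

∅-assignment : Asg Atom
∅-assignment = record { ind = λ _ → 0 , false , false ; pred = λ _ _ → ⟦ ∅-code ⟧ }

s₀ : Asg Atom
s₀ = setP ∅-assignment 1 0 ⟦ opposite-code ⟧

s₀-valid : Valid frame s₀
s₀-valid = valid-setP ∅-assignment 1 0 (λ _ _ → ⟦⟧-admissible ∅-code) (⟦⟧-admissible opposite-code)

-- Under s₀ the binary predicate variable 0 is Opposite; write O for it.
O : ℕ → ℕ → Form
O u v = app 1 0 (u ∷ v ∷ [])

-- ∃y (D y ∧ O x y ∧ ∀z (D z → z = y)), with x, y, z the individual variables 0, 1, 2
-- and D the unary predicate variable 0.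
opposite-singleton : Form
opposite-singleton = ∃ᶠ 1 (app 0 0 (1 ∷ []) ∧ᶠ (O 0 1 ∧ᶠ ∀ᵢ 2 (app 0 0 (2 ∷ []) ⇒ᶠ (2 ≐ 1))))

singleton-code : Atom → Code 1
singleton-code y₀ = decCode {P = λ { (y ∷ []) → y ≡ y₀ }} (λ { (y ∷ []) → y ≟ₐ y₀ }) (block y₀ ∷ [])
  λ { g disj (y ∷ []) gy≡y₀ → act-injective g (trans gy≡y₀ (sym (act-fixes-support g disj (here refl)))) }

opposite-singletons : (x : Atom) → ∃c λ (P : Σ (Pred Atom 1) (Admissible 0)) →
                      sat frame (setP (setI s₀ 0 x) 0 0 (proj₁ P)) opposite-singleton
opposite-singletons x ¬singleton =
  ¬singleton (⟦ singleton-code y₀ ⟧ , ⟦⟧-admissible (singleton-code y₀))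
    λ ¬witness → ¬witness y₀ (lift (λ ¬t → ¬t (fromWitness refl)) ,
                              lift (λ ¬t → ¬t (fromWitness (opposite-of-opposite x))) ,
                              λ z (Dz , z≉y₀) → z≉y₀ (lift (¬¬-map toWitness (lower Dz))))
  where
  y₀ = opposite-of x

no-choice11 : ¬ ((H : Form) (x d : ℕ) → Choice11 frame H x d)
no-choice11 choice = choice opposite-singleton 0 0 s₀ s₀-valid opposite-singletons λ (S , S-adm) singletons →
  partner-closed-atom S-adm λ (x , partner-closed) →
  singletons x λ y (Sxy , Oxy , unique) →
  lower Oxy λ opp →
  unique (partner y) (lift (partner-closed (toWitness opp) (lower Sxy)) , λ l → lower l (partner-≢ y))

-- ∃x ∀y₁ ∀y₂ (C y₁ y₂ ↔ y₁ = x ∧ O x y₂), with x, y₁, y₂ the individual variables 0, 1, 2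
-- and C the binary predicate variable 1.
opposite-fibre : Form
opposite-fibre = ∃ᶠ 0 (∀ᵢ 1 (∀ᵢ 2 (app 1 1 (1 ∷ 2 ∷ []) ⇔ᶠ ((1 ≐ 0) ∧ᶠ O 0 2))))

IsFibre : Pred Atom 2 → Atom → Set
IsFibre C x = ∀ y₁ y₂ → (¬ ¬ C (y₁ ∷ y₂ ∷ [])) ⇔ (¬ ¬ (y₁ ≡ x × Opposite x y₂))

sat-opposite-fibre : ∀ C → sat frame (setP s₀ 1 1 C) opposite-fibre ⇔ ∃c (IsFibre C)
sat-opposite-fibre C = mk⇔ (λ h ¬fibre → h λ x body → ¬fibre x (λ y₁ y₂ → body→fibre (body y₁ y₂)))
                           (λ h ¬body → h λ x fibre → ¬body x (λ y₁ y₂ → fibre→body (fibre y₁ y₂)))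
  where
  module _ {x y₁ y₂ : Atom} where
    Body : Set₁
    Body = sat frame (setI (setI (setI (setP s₀ 1 1 C) 0 x) 1 y₁) 2 y₂)
                     (app 1 1 (1 ∷ 2 ∷ []) ⇔ᶠ ((1 ≐ 0) ∧ᶠ O 0 2))
    body→fibre : Body → (¬ ¬ C (y₁ ∷ y₂ ∷ [])) ⇔ (¬ ¬ (y₁ ≡ x × Opposite x y₂))
    body→fibre (C⇒ , ⇒C) = mk⇔
      (λ Cy ¬both → C⇒ (lift Cy , λ (l₁ , l₂) → lower l₁ λ y₁≡x → lower l₂ λ opp → ¬both (y₁≡x , toWitness opp)))
      (λ both ¬Cy → both λ (y₁≡x , opp) →
         ⇒C ((lift (λ ¬≡ → ¬≡ y₁≡x) , lift (λ ¬opp → ¬opp (fromWitness opp))) , λ l → lower l ¬Cy))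
    fibre→body : (¬ ¬ C (y₁ ∷ y₂ ∷ [])) ⇔ (¬ ¬ (y₁ ≡ x × Opposite x y₂)) → Body
    fibre→body C⇔ =
      (λ (l , ¬both) → to C⇔ (lower l) λ (y₁≡x , opp) →
         ¬both (lift (λ ¬≡ → ¬≡ y₁≡x) , lift (λ ¬opp → ¬opp (fromWitness opp)))) ,
      (λ ((l₁ , l₂) , ¬Cy) → ¬Cy (lift (from C⇔ λ ¬both →
         lower l₁ λ y₁≡x → lower l₂ λ opp → ¬both (y₁≡x , toWitness opp))))

InFibre : Atom → Vec Atom 2 → Set
InFibre x (y₁ ∷ y₂ ∷ []) = y₁ ≡ x × Opposite x y₂

fibre-code : Atom → Code 2
fibre-code x =
  decCode {P = InFibre x} (λ { (y₁ ∷ y₂ ∷ []) → (y₁ ≟ₐ x) ×-dec opposite? x y₂ }) (block x ∷ []) supported-at-x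
  where
  supported-at-x : Supported (block x ∷ []) (InFibre x)
  supported-at-x g disj (y₁ ∷ y₂ ∷ []) (gy₁≡x , opp) =
    act-injective g (trans gy₁≡x (sym gx)) ,
    opposite-invariant g (subst (λ u → Opposite u (act g y₂)) (sym gx) opp)
    where
    gx : act g x ≡ x
    gx = act-fixes-support g disj (here refl)

fibre-code-is-fibre : ∀ x → IsFibre ⟦ fibre-code x ⟧ x
fibre-code-is-fibre x y₁ y₂ = mk⇔ (¬¬-map toWitness) (¬¬-map fromWitness)

IsOppositeFibre : Pred Atom 2 → Set₁
IsOppositeFibre C = sat frame (setP s₀ 1 1 C) opposite-fibre

fibres-nonempty : (C : Pred Atom 2) → Admissible 1 C → IsOppositeFibre C → ∃c λ y₁ → ∃c λ y₂ → at2 frame C y₁ y₂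
fibres-nonempty C _ h ¬pair = to (sat-opposite-fibre C) h λ x fibre →
  ¬pair x λ ¬y₂ → ¬y₂ (opposite-of x) (from (fibre x (opposite-of x)) λ ¬both → ¬both (refl , opposite-of-opposite x))

fibres-disjoint : (C₁ C₂ : Pred Atom 2) → Admissible 1 C₁ → Admissible 1 C₂ →
                  IsOppositeFibre C₁ → IsOppositeFibre C₂ → _≉₂_ frame C₁ C₂ →
                  ¬ ∃c (λ y₁ → ∃c λ y₂ → at2 frame C₁ y₁ y₂ × at2 frame C₂ y₁ y₂)
fibres-disjoint C₁ C₂ _ _ h₁ h₂ C₁≉C₂ common =
  to (sat-opposite-fibre C₁) h₁ λ x₁ fibre₁ → to (sat-opposite-fibre C₂) h₂ λ x₂ fibre₂ →
  common λ y₁ ∃y₂ → ∃y₂ λ y₂ (C₁y , C₂y) →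
  to (fibre₁ y₁ y₂) C₁y λ (y₁≡x₁ , _) → to (fibre₂ y₁ y₂) C₂y λ (y₁≡x₂ , _) →
  C₁≉C₂ (same-fibre (trans (sym y₁≡x₁) y₁≡x₂) fibre₁ fibre₂)
  where
  same-fibre : ∀ {x₁ x₂} → x₁ ≡ x₂ → IsFibre C₁ x₁ → IsFibre C₂ x₂ →
               (y₁ y₂ : Atom) → at2 frame C₁ y₁ y₂ ⇔c at2 frame C₂ y₁ y₂
  same-fibre refl fibre₁ fibre₂ y₁ y₂ = to C₁⇔C₂ , from C₁⇔C₂
    where
    C₁⇔C₂ = ⇔-trans (fibre₁ y₁ y₂) (⇔-sym (fibre₂ y₁ y₂))

no-choice2 : ¬ ((H : Form) (c : ℕ) → Choice2 frame H c)
no-choice2 choice = choice opposite-fibre 1 s₀ s₀-valid (fibres-nonempty , fibres-disjoint) λ (S , S-adm) selects →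
  partner-closed-atom S-adm λ (x , partner-closed) →
  selects ⟦ fibre-code x ⟧ (⟦⟧-admissible (fibre-code x))
    (from (sat-opposite-fibre ⟦ fibre-code x ⟧) λ ¬fibre → ¬fibre x (fibre-code-is-fibre x))
    λ y₁ ∃y₂ → ∃y₂ λ y₂ ((Cy , Sy) , unique) → Cy λ t → refute {S} partner-closed (toWitness t) Sy unique
  where
  refute : ∀ {S : Pred Atom 2} {x y₁ y₂} → PartnerClosedOpposite S x →
           y₁ ≡ x × Opposite x y₂ → at2 frame S y₁ y₂ →
           ((z₁ z₂ : Atom) → at2 frame ⟦ fibre-code x ⟧ z₁ z₂ × at2 frame S z₁ z₂ →
              _≈_ frame z₁ y₁ × _≈_ frame z₂ y₂) →
           ⊥
  refute {y₂ = y₂} partner-closed (refl , opp) Sy unique =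
    proj₂ (unique _ (partner y₂) ((λ ¬t → ¬t (fromWitness (refl , opp))) , partner-closed opp Sy)) (partner-≢ y₂)

corollary2p6 : Σ HenkinStructure λ M →
    AC11 (HenkinStructure.frame M)
    × ¬ ((H : Form) (c : ℕ) → Choice2 (HenkinStructure.frame M) H c)
    × ¬ ((H : Form) (x d : ℕ) → Choice11 (HenkinStructure.frame M) H x d)
corollary2p6 = model , ac11 , no-choice2 , no-choice11
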